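{- Let $n\ge 1$ and let $K_{n+1}$ be the complete graph on $n+1$ vertices. For every vertex $P\in V(K_{n+1})$ we have $H_r(P)=\langle n,n+1\rangle$, the additive submonoid of $\mathbb{N}$ generated by $n$ and $n+1$.
   Context: $\mathbb{N}=\{0,1,2,\dots\}$. A divisor on a graph $G$ is a formal integer combination $D=\sum_{Q\in V(G)}D(Q)\,Q$; $\deg D=\sum_Q D(Q)$; effective means all coefficients $\ge0$. For $f:V(G)\to\mathbb{Z}$, $\Delta f$ is the divisor with $\Delta f(Q)=\sum_{e=QR\in E(G)}(f(Q)-f(R))$. $|D|=\{E\ge 0:E-D=\Delta f\text{ for some }f\}$. The rank $r(D)$ is $-1$ if $|D|=\emptyset$, and otherwise the largest $k\ge 0$ such that $|D-E|\neq\emptyset$ for every effective divisor $E$ of degree $k$. For $P\in V(G)$, $H_r(P)=\{m\in\mathbb{N}: r(mP)>r((m-1)P)\}$. -}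

module Defs where

open import Data.Nat as ℕ using (ℕ; zero; suc)
open import Data.Integer as ℤ using (ℤ; +_; _-_; _*_; _≤_; _<_; -_)
open import Data.Fin using (Fin; _≟_)
open import Data.List using (List; foldr; map; allFin)
open import Data.Bool using (if_then_else_)
open import Data.Product using (Σ; ∃; _×_; _,_)
open import Data.Sum using (_⊎_)
open import Relation.Nullary using (¬_; does)
open import Relation.Binary.PropositionalEquality using (_≡_)

-- A finite (multi)graph: vertices Fin V, adj Q R = number of edges between Q and R.
record Graph : Set where
  field
    V   : ℕ
    adj : Fin V → Fin V → ℕ
open Graph public

K : ℕ → Graph
K k = record { V = k ; adj = λ i j → if does (i ≟ j) then 0 else 1 }

Divisor : Graph → Set
Divisor G = Fin (V G) → ℤ

Σv : (G : Graph) → (Fin (V G) → ℤ) → ℤ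
Σv G g = foldr ℤ._+_ (+ 0) (map g (allFin (V G)))

deg : (G : Graph) → Divisor G → ℤ
deg G D = Σv G D

Effective : (G : Graph) → Divisor G → Set
Effective G D = ∀ Q → + 0 ≤ D Q

_⊕_ : {G : Graph} → Divisor G → Divisor G → Divisor G
(D ⊕ E) Q = D Q ℤ.+ E Q

_⊖_ : {G : Graph} → Divisor G → Divisor G → Divisor G
(D ⊖ E) Q = D Q - E Q

Δ : (G : Graph) → (Fin (V G) → ℤ) → Divisor G
Δ G f Q = Σv G (λ R → + (adj G Q R) * (f Q - f R))

InLinSys : {G : Graph} → Divisor G → Divisor G → Set
InLinSys {G} E D = Effective G E × ∃ λ (f : Fin (V G) → ℤ) → ∀ Q → (_⊖_ {G} E D) Q ≡ Δ G f Q

LinSysNonempty : (G : Graph) → Divisor G → Set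
LinSysNonempty G D = ∃ λ (E : Divisor G) → InLinSys {G} E D

RankCond : (G : Graph) → Divisor G → ℕ → Set
RankCond G D k = ∀ (E : Divisor G) → Effective G E → deg G E ≡ + k → LinSysNonempty G (_⊖_ {G} D E)

HasRank : (G : Graph) → Divisor G → ℤ → Set
HasRank G D r =
  (r ≡ - (+ 1) × ¬ LinSysNonempty G D)
  ⊎ (∃ λ (k : ℕ) → r ≡ + k × LinSysNonempty G D × RankCond G D k
                   × (∀ k′ → k ℕ.< k′ → ¬ RankCond G D k′))

_·_ : {G : Graph} → ℤ → Fin (V G) → Divisor G
(c · P) Q = if does (P ≟ Q) then c else + 0

InHr : (G : Graph) → Fin (V G) → ℕ → Set
InHr G P m = ∃ λ r₁ → ∃ λ r₀ →
  HasRank G (_·_ {G} (+ m) P) r₁ × HasRank G (_·_ {G} (+ m - + 1) P) r₀ × r₀ < r₁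

InMonoid₂ : ℕ → ℕ → ℕ → Set
InMonoid₂ a b m = ∃ λ x → ∃ λ y → m ≡ x ℕ.* a ℕ.+ y ℕ.* b

module Submission where

open import Defs
open import Data.Nat using (ℕ; suc; _≥_)
open import Data.Fin using (Fin)
open import Data.Product using (_×_)

-- On K (n + 1) one has Δ f (Q) = (n + 1) f (Q) - Σ f.  Writing vᵢ for the vertices other than P,
-- |D| ≠ ∅ therefore holds iff, for any fixed c ∈ ℤ, some h : Fin n → ℤ satisfies
-- Σ h + n c ≤ D (P) and Σ h ≤ (n + 1) hᵢ + c + D (vᵢ) (namely hᵢ = f (vᵢ) - f (P) - c).
-- With this criterion one shows r (m P) = σ (m), the number of nonzero elements of ⟨n, n + 1⟩ that
-- are at most m; as σ (m) - σ (m - 1) = 1 exactly when m ∈ ⟨n, n + 1⟩, and r (- P) = -1, the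
-- theorem follows.
--
-- r (m P) ≥ σ (m): write the coefficients of an effective E of degree σ (m) as eᵢ = bᵢ + (n + 1) aᵢ
-- with bᵢ ≤ n, let u minimise u + #{i | bᵢ > u} and let δ be that count at u.  A layer-cake count
-- gives triangle (u + δ) + δ ≤ Σ b, and T = (u + δ) n + δ ∈ ⟨n, n + 1⟩ has σ (T) = triangle (u + δ) + δ,
-- so the budget E (P) + Σ e = σ (m) forces T + E (P) + (n + 1) Σ a ≤ m.  That is what the choice
-- hᵢ = u + [u < bᵢ] + aᵢ + δ + Σ a (with c = 0) needs.
--
-- r (m P) < σ (m) + 1: choose q ≤ n and j with triangle q + j = σ (m) + 1 and m < q n + j, and take
-- the staircase E = j P + Σ (q - i) vᵢ.  If |m P - E| ≠ ∅, the criterion with c = q gives h with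
-- Σ h ≤ (n + 1) hᵢ + i; at the first minimum of h this forces Σ h ≥ 0, and then q n + j ≤ m.

module LayerCake where

  open import Data.Nat
  open import Data.Nat.Properties
  open import Data.Fin using (Fin; toℕ)
  open import Data.Bool using (if_then_else_)
  open import Data.Product using (Σ; _×_; _,_)
  open import Data.Sum using (inj₁; inj₂)
  open import Data.Empty using (⊥-elim)
  open import Function using (_∘_)
  open import Relation.Nullary using (yes; no)
  open import Relation.Binary.PropositionalEquality
  open import Algebra.Properties.Semiring.Sum +-*-semiring
    using (sum; sum-cong-≗; ∑-comm; ∑-distrib-+)

  triangle : ℕ → ℕ
  triangle zero = 0
  triangle (suc q) = suc q + triangle q

  ⟦_<_⟧ : ℕ → ℕ → ℕ
  ⟦ u < x ⟧ = if u <ᵇ x then 1 else 0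

  ⟦<⟧-true : ∀ {u x} → u < x → ⟦ u < x ⟧ ≡ 1
  ⟦<⟧-true {zero}  {suc x} _          = refl
  ⟦<⟧-true {suc u} {suc x} (s≤s u<x) = ⟦<⟧-true u<x

  ⟦<⟧-false : ∀ {u x} → x ≤ u → ⟦ u < x ⟧ ≡ 0
  ⟦<⟧-false {u}     {zero}  _          = refl
  ⟦<⟧-false {suc u} {suc x} (s≤s x≤u) = ⟦<⟧-false x≤u

  ⟦<⟧-bound : ∀ {n x} u → x ≤ n → x ≤ u + suc n * ⟦ u < x ⟧
  ⟦<⟧-bound {n} {x} u x≤n with u <? x
  ... | yes u<x rewrite ⟦<⟧-true u<x = ≤-trans (m≤n⇒m≤1+n x≤n) (≤-trans (m≤m*n (suc n) 1) (m≤n+m _ u))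
  ... | no u≮x  rewrite ⟦<⟧-false (≮⇒≥ u≮x) = ≤-trans (≮⇒≥ u≮x) (m≤m+n u _)

  sum-const : ∀ k c → sum {k} (λ _ → c) ≡ k * c
  sum-const zero    c = refl
  sum-const (suc k) c = cong (c +_) (sum-const k c)

  ∑< : ℕ → (ℕ → ℕ) → ℕ
  ∑< L g = sum {L} (g ∘ toℕ)

  ∑<-monoʳ-≤ : ∀ L {g h : ℕ → ℕ} → (∀ u → u < L → g u ≤ h u) → ∑< L g ≤ ∑< L h
  ∑<-monoʳ-≤ zero    g≤h = z≤n
  ∑<-monoʳ-≤ (suc L) g≤h = +-mono-≤ (g≤h 0 z<s) (∑<-monoʳ-≤ L (λ u u<L → g≤h (suc u) (s<s u<L)))

  ∑<-monoˡ-≤ : ∀ {k L} g → k ≤ L → ∑< k g ≤ ∑< L g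
  ∑<-monoˡ-≤ {zero}          g _         = z≤n
  ∑<-monoˡ-≤ {suc k} {suc L} g (s≤s k≤L) = +-monoʳ-≤ (g 0) (∑<-monoˡ-≤ (g ∘ suc) k≤L)

  ∑<-⟦<⟧ : ∀ L x → ∑< L (λ u → ⟦ u < x ⟧) ≡ x ⊓ L
  ∑<-⟦<⟧ zero    zero    = refl
  ∑<-⟦<⟧ zero    (suc x) = refl
  ∑<-⟦<⟧ (suc L) zero    = ∑<-⟦<⟧ L zero
  ∑<-⟦<⟧ (suc L) (suc x) = cong suc (∑<-⟦<⟧ L x)

  ∑<-⟦>⟧ : ∀ L c → ∑< L (λ u → ⟦ c < u ⟧) ≡ L ∸ suc c
  ∑<-⟦>⟧ zero    c       = refl
  ∑<-⟦>⟧ (suc L) zero    = trans (sum-const L 1) (*-identityʳ L)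
  ∑<-⟦>⟧ (suc L) (suc c) = ∑<-⟦>⟧ L c

  ∑<-∸ : ∀ {L} q → q ≤ L → ∑< L (q ∸_) ≡ triangle q
  ∑<-∸ {L}     zero    _         = trans (sum-cong-≗ {L} (0∸n≡0 ∘ toℕ)) (trans (sum-const L 0) (*-zeroʳ L))
  ∑<-∸ {suc L} (suc q) (s≤s q≤L) = cong (suc q +_) (∑<-∸ q q≤L)

  countAbove : ∀ {n} → (Fin n → ℕ) → ℕ → ℕ
  countAbove b u = sum (λ i → ⟦ u < b i ⟧)

  layer-cake : ∀ {n} L (b : Fin n → ℕ) → (∀ i → b i ≤ L) → sum b ≡ ∑< L (countAbove b)
  layer-cake {n} L b b≤L = trans
    (sum-cong-≗ (λ i → sym (trans (∑<-⟦<⟧ L (b i)) (m≤n⇒m⊓n≡m (b≤L i)))))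
    (∑-comm {n} {L} (λ i u → ⟦ toℕ u < b i ⟧))

  last-minimiser : ∀ (h : ℕ → ℕ) w → Σ ℕ λ u → u ≤ w
    × (∀ v → v ≤ w → h u ≤ h v) × (∀ v → v ≤ w → u < v → h u < h v)
  last-minimiser h zero = 0 , z≤n , (λ { zero _ → ≤-refl }) , (λ { zero _ () })
  last-minimiser h (suc w) with last-minimiser h w
  ... | u , u≤w , minimal , last with h (suc w) ≤? h u
  ...   | yes hw≤hu = suc w , ≤-refl , minimal′ , (λ v v≤ w<v → ⊥-elim (<⇒≱ w<v v≤))
    where
    minimal′ : ∀ v → v ≤ suc w → h (suc w) ≤ h v
    minimal′ v v≤ with m≤n⇒m<n∨m≡n v≤
    ... | inj₁ v<  = ≤-trans hw≤hu (minimal v (s≤s⁻¹ v<))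
    ... | inj₂ refl = ≤-refl
  ...   | no hw≰hu = u , m≤n⇒m≤1+n u≤w , minimal′ , last′
    where
    minimal′ : ∀ v → v ≤ suc w → h u ≤ h v
    minimal′ v v≤ with m≤n⇒m<n∨m≡n v≤
    ... | inj₁ v<  = minimal v (s≤s⁻¹ v<)
    ... | inj₂ refl = <⇒≤ (≰⇒> hw≰hu)
    last′ : ∀ v → v ≤ suc w → u < v → h u < h v
    last′ v v≤ u<v with m≤n⇒m<n∨m≡n v≤
    ... | inj₁ v<  = last v (s≤s⁻¹ v<) u<v
    ... | inj₂ refl = ≰⇒> hw≰hu

  staircase-bound : ∀ {n} (b : Fin n → ℕ) → (∀ i → b i ≤ n) → Σ ℕ λ u →
    u + countAbove b u ≤ n × triangle (u + countAbove b u) + countAbove b u ≤ sum b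
  staircase-bound {n} b b≤n with last-minimiser (λ v → v + countAbove b v) n
  ... | u , _ , minimal , last = u , k≤n , bound
    where
    δ = countAbove b u
    k = u + δ

    k≤n : k ≤ n
    k≤n = begin
      k                       ≤⟨ minimal n ≤-refl ⟩
      n + countAbove b n      ≡⟨ cong (n +_) (sum-cong-≗ {n} (λ i → ⟦<⟧-false (b≤n i))) ⟩
      n + sum {n} (λ _ → 0)   ≡⟨ cong (n +_) (trans (sum-const n 0) (*-zeroʳ n)) ⟩
      n + 0                   ≡⟨ +-identityʳ n ⟩
      n                       ∎
      where open ≤-Reasoning

    step≤count : ∀ v → v < suc k → (k ∸ v) + ⟦ u < v ⟧ ≤ countAbove b v
    step≤count v v≤k with u <? v
    ... | yes u<v = begin
      (k ∸ v) + ⟦ u < v ⟧  ≡⟨ cong ((k ∸ v) +_) (⟦<⟧-true u<v) ⟩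
      (k ∸ v) + 1          ≡⟨ +-comm (k ∸ v) 1 ⟩
      suc (k ∸ v)          ≡⟨ +-∸-assoc 1 (s≤s⁻¹ v≤k) ⟨
      suc k ∸ v            ≤⟨ m≤n+o⇒m∸n≤o (suc k) v (last v (≤-trans (s≤s⁻¹ v≤k) k≤n) u<v) ⟩
      countAbove b v       ∎
      where open ≤-Reasoning
    ... | no u≮v = begin
      (k ∸ v) + ⟦ u < v ⟧  ≡⟨ cong ((k ∸ v) +_) (⟦<⟧-false (≮⇒≥ u≮v)) ⟩
      (k ∸ v) + 0          ≡⟨ +-identityʳ _ ⟩
      k ∸ v                ≤⟨ m≤n+o⇒m∸n≤o k v (minimal v (≤-trans (s≤s⁻¹ v≤k) k≤n)) ⟩
      countAbove b v       ∎
      where open ≤-Reasoning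

    bound : triangle k + δ ≤ sum b
    bound = begin
      triangle k + δ
        ≡⟨ cong₂ _+_ (∑<-∸ k (n≤1+n k)) (trans (∑<-⟦>⟧ (suc k) u) (m+n∸m≡n u δ)) ⟨
      ∑< (suc k) (k ∸_) + ∑< (suc k) (λ v → ⟦ u < v ⟧)
        ≡⟨ ∑-distrib-+ {suc k} (λ v → k ∸ toℕ v) (λ v → ⟦ u < toℕ v ⟧) ⟨
      ∑< (suc k) (λ v → (k ∸ v) + ⟦ u < v ⟧)
        ≤⟨ ∑<-monoʳ-≤ (suc k) step≤count ⟩
      ∑< (suc k) (countAbove b)
        ≤⟨ ∑<-monoˡ-≤ (countAbove b) (s≤s k≤n) ⟩
      ∑< (suc n) (countAbove b)
        ≡⟨ layer-cake (suc n) b (m≤n⇒m≤1+n ∘ b≤n) ⟨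
      sum b
        ∎
      where open ≤-Reasoning

module NumericalSemigroup (n0 : ℕ) where

  open import Data.Nat
  open import Data.Nat.Properties
  open import Data.Nat.DivMod
  open import Data.Nat.Tactic.RingSolver using (solve-∀)
  open import Data.Fin using (Fin)
  open import Data.Bool using (true; false; if_then_else_)
  open import Data.Product using (Σ; _×_; _,_)
  open import Data.Sum using (inj₁; inj₂)
  open import Data.Empty using (⊥-elim)
  open import Function using (_∘_)
  open import Relation.Nullary using (yes; no; does)
  open import Relation.Nullary.Decidable using (dec-true; dec-false)
  open import Relation.Binary.PropositionalEquality
  open import Algebra.Properties.Semiring.Sum +-*-semiring
    using (sum; sum-cong-≗; ∑-distrib-+; *-distribˡ-sum)
  open import Defs using (InMonoid₂)
  open LayerCake

  n : ℕ
  n = suc n0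

  quot-rem : ∀ m → m ≡ m / n * n + m % n
  quot-rem m = trans (m≡m%n+[m/n]*n m n) (+-comm (m % n) _)

  block-quot-rem : ∀ q {j} → j < n → (q * n + j) / n ≡ q × (q * n + j) % n ≡ j
  block-quot-rem q {j} j<n = quotient , remainder
    where
    remainder : (q * n + j) % n ≡ j
    remainder = trans (cong (_% n) (+-comm (q * n) j)) (trans ([m+kn]%n≡m%n j q n) (m<n⇒m%n≡m j<n))
    quotient : (q * n + j) / n ≡ q
    quotient = begin
      (q * n + j) / n    ≡⟨ +-distrib-/ (q * n) j remainders<n ⟩
      q * n / n + j / n  ≡⟨ cong₂ _+_ (m*n/n≡m q n) (m<n⇒m/n≡0 j<n) ⟩
      q + 0              ≡⟨ +-identityʳ q ⟩
      q                  ∎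
      where
      open ≡-Reasoning
      remainders<n : (q * n) % n + j % n < n
      remainders<n = subst₂ (λ a b → a + b < n) (sym (m*n%n≡0 q n)) (sym (m<n⇒m%n≡m j<n)) j<n

  -- Writing x = q n + j with j < n, x lies in ⟨n, n + 1⟩ iff j ≤ q.
  χ : ℕ → ℕ
  χ x = if does (x % n ≤? x / n) then 1 else 0

  -- σ m counts the nonzero elements of ⟨n, n + 1⟩ up to m; it is the rank of m P on K (n + 1).
  σ : ℕ → ℕ
  σ zero    = 0
  σ (suc x) = σ x + χ (suc x)

  χ≤1 : ∀ x → χ x ≤ 1
  χ≤1 x with does (x % n ≤? x / n)
  ... | true  = ≤-refl
  ... | false = z≤n

  χ-positive : ∀ x → 0 < χ x → x % n ≤ x / n
  χ-positive x 0<χ with x % n ≤? x / n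
  ... | yes r≤q = r≤q
  ... | no r≰q rewrite dec-false (x % n ≤? x / n) r≰q = ⊥-elim (n≮0 0<χ)

  χ-block : ∀ q {j} → j < n → j ≤ q → χ (q * n + j) ≡ 1
  χ-block q {j} j<n j≤q with block-quot-rem q j<n
  ... | q≡ , j≡ rewrite dec-true (_ ≤? _) (subst₂ _≤_ (sym j≡) (sym q≡) j≤q) = refl

  χ-gap : ∀ q {j} → j < n → q < j → χ (q * n + j) ≡ 0
  χ-gap q {j} j<n q<j with block-quot-rem q j<n
  ... | q≡ , j≡ rewrite dec-false (_ ≤? _) (<⇒≱ q<j ∘ subst₂ _≤_ j≡ q≡) = refl

  χ-beyond : ∀ y → χ (n0 * n + y) ≡ 1
  χ-beyond y = trans (cong χ shift) (χ-block (n0 + y / n) (m%n<n y n) (≤-trans (s≤s⁻¹ (m%n<n y n)) (m≤m+n n0 _)))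
    where
    shift : n0 * n + y ≡ (n0 + y / n) * n + y % n
    shift = trans (cong (n0 * n +_) (quot-rem y)) (merge n0 (y / n) (y % n) n)
      where
      merge : ∀ c q r n → c * n + (q * n + r) ≡ (c + q) * n + r
      merge = solve-∀

  χ-positive⇒∈⟨n,n+1⟩ : ∀ x → 0 < χ x → InMonoid₂ n (suc n) x
  χ-positive⇒∈⟨n,n+1⟩ x 0<χ = x / n ∸ x % n , x % n , (begin
    x                                      ≡⟨ quot-rem x ⟩
    x / n * n + x % n                      ≡⟨ cong (λ q → q * n + x % n) (m∸n+n≡m (χ-positive x 0<χ)) ⟨
    (x / n ∸ x % n + x % n) * n + x % n    ≡⟨ lemma (x / n ∸ x % n) (x % n) n ⟩
    (x / n ∸ x % n) * n + x % n * suc n    ∎)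
    where
    open ≡-Reasoning
    lemma : ∀ a b n → (a + b) * n + b ≡ a * n + b * suc n
    lemma = solve-∀

  ∈⟨n,n+1⟩⇒χ≡1 : ∀ x → InMonoid₂ n (suc n) x → χ x ≡ 1
  ∈⟨n,n+1⟩⇒χ≡1 x (a , b , x≡) = trans (cong χ regroup)
    (χ-block (a + b + b / n) (m%n<n b n) (≤-trans (m%n≤m b n) (≤-trans (m≤n+m b a) (m≤m+n (a + b) _))))
    where
    regroup : x ≡ (a + b + b / n) * n + b % n
    regroup = begin
      x                               ≡⟨ x≡ ⟩
      a * n + b * suc n               ≡⟨ split-off a b n ⟩
      (a + b) * n + b                 ≡⟨ cong ((a + b) * n +_) (quot-rem b) ⟩
      (a + b) * n + (b / n * n + b % n) ≡⟨ merge (a + b) (b / n) (b % n) n ⟩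
      (a + b + b / n) * n + b % n     ∎
      where
      open ≡-Reasoning
      split-off : ∀ a b n → a * n + b * suc n ≡ (a + b) * n + b
      split-off = solve-∀
      merge : ∀ c q r n → c * n + (q * n + r) ≡ (c + q) * n + r
      merge = solve-∀

  σ-increase⇒∈ : ∀ m → σ m < σ (suc m) → InMonoid₂ n (suc n) (suc m)
  σ-increase⇒∈ m σm<σ1+m = χ-positive⇒∈⟨n,n+1⟩ (suc m)
    (+-cancelˡ-< (σ m) 0 _ (subst (_< σ (suc m)) (sym (+-identityʳ (σ m))) σm<σ1+m))

  ∈⇒σ-increase : ∀ m → InMonoid₂ n (suc n) (suc m) → σ m < σ (suc m)
  ∈⇒σ-increase m mem = m<m+n (σ m) (subst (0 <_) (sym (∈⟨n,n+1⟩⇒χ≡1 (suc m) mem)) z<s)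

  σ-suc : ∀ {x y} → x ≡ suc y → σ x ≡ σ y + χ x
  σ-suc refl = refl

  σ-mono-≤ : ∀ {a b} → a ≤ b → σ a ≤ σ b
  σ-mono-≤ {b = zero}  z≤n = ≤-refl
  σ-mono-≤ {a} {suc b} a≤b with m≤n⇒m<n∨m≡n a≤b
  ... | inj₁ a<b  = ≤-trans (σ-mono-≤ (s≤s⁻¹ a<b)) (m≤m+n (σ b) _)
  ... | inj₂ refl = ≤-refl

  σ-+-≤ : ∀ a c → σ (c + a) ≤ σ a + c
  σ-+-≤ a zero    = ≤-reflexive (sym (+-identityʳ (σ a)))
  σ-+-≤ a (suc c) = begin
    σ (c + a) + χ (suc (c + a))  ≤⟨ +-mono-≤ (σ-+-≤ a c) (χ≤1 (suc (c + a))) ⟩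
    σ a + c + 1                  ≡⟨ +-assoc (σ a) c 1 ⟩
    σ a + (c + 1)                ≡⟨ cong (σ a +_) (+-comm c 1) ⟩
    σ a + suc c                  ∎
    where open ≤-Reasoning

  σ≤id : ∀ x → σ x ≤ x
  σ≤id x = subst (λ y → σ y ≤ x) (+-identityʳ x) (σ-+-≤ 0 x)

  σ-jump : ∀ T c m → χ T ≡ 1 → m < T + c → σ m < σ T + c
  σ-jump zero     c m _     m<c = ≤-<-trans (σ≤id m) m<c
  σ-jump (suc T′) c m χT≡1 m<T+c = begin-strict
    σ m               ≤⟨ σ-mono-≤ (s≤s⁻¹ m<T+c) ⟩
    σ (T′ + c)        ≡⟨ cong σ (+-comm T′ c) ⟩
    σ (c + T′)        ≤⟨ σ-+-≤ T′ c ⟩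
    σ T′ + c          <⟨ n<1+n _ ⟩
    suc (σ T′ + c)    ≡⟨ cong (_+ c) (trans (+-comm 1 (σ T′)) (cong (σ T′ +_) (sym χT≡1))) ⟩
    σ (suc T′) + c    ∎
    where open ≤-Reasoning

  σ-budget : ∀ T c m → χ T ≡ 1 → σ T + c ≤ σ m → T + c ≤ m
  σ-budget T c m χT≡1 fits = ≮⇒≥ (λ m< → <⇒≱ (σ-jump T c m χT≡1 m<) fits)

  σ-block : ∀ q j → q < n → j < n → σ (q * n + j) ≡ triangle q + j ⊓ q
  σ-block zero    zero    _   _ = refl
  σ-block (suc q) zero    q<n _ = begin
    σ (suc q * n + 0)                      ≡⟨ σ-suc (block-start q n0) ⟩
    σ (q * n + n0) + χ (suc q * n + 0)     ≡⟨ cong₂ _+_ (σ-block q n0 (<⇒≤ q<n) ≤-refl) (χ-block (suc q) z<s z≤n) ⟩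
    triangle q + n0 ⊓ q + 1                ≡⟨ cong (λ z → triangle q + z + 1) (m≥n⇒m⊓n≡n (s≤s⁻¹ (<⇒≤ q<n))) ⟩
    triangle q + q + 1                     ≡⟨ rearrange (triangle q) q ⟩
    triangle (suc q) + 0 ⊓ suc q           ∎
    where
    open ≡-Reasoning
    block-start : ∀ q n0 → suc q * suc n0 + 0 ≡ suc (q * suc n0 + n0)
    block-start = solve-∀
    rearrange : ∀ t q → t + q + 1 ≡ suc q + t + 0
    rearrange = solve-∀
  σ-block q (suc j) q<n j<n with suc j ≤? q
  ... | yes j<q = begin
    σ (q * n + suc j)                      ≡⟨ σ-suc (+-suc (q * n) j) ⟩
    σ (q * n + j) + χ (q * n + suc j)      ≡⟨ cong₂ _+_ (σ-block q j q<n (<⇒≤ j<n)) (χ-block q j<n j<q) ⟩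
    triangle q + j ⊓ q + 1                 ≡⟨ cong (λ z → triangle q + z + 1) (m≤n⇒m⊓n≡m (<⇒≤ j<q)) ⟩
    triangle q + j + 1                     ≡⟨ trans (+-assoc (triangle q) j 1) (cong (triangle q +_) (+-comm j 1)) ⟩
    triangle q + suc j                     ≡⟨ cong (triangle q +_) (m≤n⇒m⊓n≡m j<q) ⟨
    triangle q + suc j ⊓ q                 ∎
    where open ≡-Reasoning
  ... | no j≮q = begin
    σ (q * n + suc j)                      ≡⟨ σ-suc (+-suc (q * n) j) ⟩
    σ (q * n + j) + χ (q * n + suc j)      ≡⟨ cong₂ _+_ (σ-block q j q<n (<⇒≤ j<n)) (χ-gap q j<n (≰⇒> j≮q)) ⟩
    triangle q + j ⊓ q + 0                 ≡⟨ +-identityʳ _ ⟩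
    triangle q + j ⊓ q                     ≡⟨ cong (triangle q +_) (m≥n⇒m⊓n≡n (s≤s⁻¹ (≰⇒> j≮q))) ⟩
    triangle q + q                         ≡⟨ cong (triangle q +_) (m≥n⇒m⊓n≡n (<⇒≤ (≰⇒> j≮q))) ⟨
    triangle q + suc j ⊓ q                 ∎
    where open ≡-Reasoning

  σ-beyond : ∀ x → σ (n0 * n + x) ≡ triangle n0 + x
  σ-beyond zero    = σ-block n0 0 ≤-refl z<s
  σ-beyond (suc x) = begin
    σ (n0 * n + suc x)                     ≡⟨ σ-suc (+-suc (n0 * n) x) ⟩
    σ (n0 * n + x) + χ (n0 * n + suc x)    ≡⟨ cong₂ _+_ (σ-beyond x) (χ-beyond (suc x)) ⟩
    triangle n0 + x + 1                    ≡⟨ trans (+-assoc (triangle n0) x 1) (cong (triangle n0 +_) (+-comm x 1)) ⟩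
    triangle n0 + suc x                    ∎
    where open ≡-Reasoning

  σ-staircase : ∀ k δ → δ ≤ k → k ≤ n → σ (k * n + δ) ≡ triangle k + δ × χ (k * n + δ) ≡ 1
  σ-staircase k δ δ≤k k≤n with m≤n⇒m<n∨m≡n k≤n
  ... | inj₁ k<n  = trans (σ-block k δ k<n (≤-<-trans δ≤k k<n)) (cong (triangle k +_) (m≤n⇒m⊓n≡m δ≤k))
                  , χ-block k (≤-<-trans δ≤k k<n) δ≤k
  ... | inj₂ refl = trans (cong σ shift) (trans (σ-beyond (n + δ)) (rearrange (triangle n0) n0 δ))
                  , trans (cong χ shift) (χ-beyond (n + δ))
    where
    shift : n * n + δ ≡ n0 * n + (n + δ)
    shift = lemma n0 δ
      where
      lemma : ∀ n0 δ → suc n0 * suc n0 + δ ≡ n0 * suc n0 + (suc n0 + δ)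
      lemma = solve-∀
    rearrange : ∀ t n0 δ → t + (suc n0 + δ) ≡ suc n0 + t + δ
    rearrange = solve-∀

  σ-in-block : ∀ m → m / n < n → σ m ≡ triangle (m / n) + (m % n) ⊓ (m / n)
  σ-in-block m Q<n = trans (cong σ (quot-rem m)) (σ-block (m / n) (m % n) Q<n (m%n<n m n))

  next-staircase : ∀ m → Σ ℕ λ q → Σ ℕ λ j →
    q ≤ n × m < q * n + j × triangle q + j ≡ suc (σ m)
  next-staircase m with n0 ≤? m / n
  ... | yes n0≤Q = n0 , suc x , n≤1+n n0 , m<end , (begin
    triangle n0 + suc x        ≡⟨ +-suc (triangle n0) x ⟩
    suc (triangle n0 + x)      ≡⟨ cong suc (σ-beyond x) ⟨
    suc (σ (n0 * n + x))       ≡⟨ cong (suc ∘ σ) m≡ ⟨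
    suc (σ m)                  ∎)
    where
    open ≡-Reasoning
    x = m ∸ n0 * n
    m≡ : m ≡ n0 * n + x
    m≡ = sym (m+[n∸m]≡n (≤-trans (*-monoˡ-≤ n n0≤Q) (m/n*n≤m m n)))
    m<end : m < n0 * n + suc x
    m<end = subst (m <_) (sym (+-suc (n0 * n) x)) (s≤s (≤-reflexive m≡))
  ... | no n0≰Q with m % n <? m / n
  ...   | yes R<Q = Q , suc R , ≤-trans (<⇒≤ Q<n0) (n≤1+n n0) , m<end , (begin
    triangle Q + suc R         ≡⟨ +-suc (triangle Q) R ⟩
    suc (triangle Q + R)       ≡⟨ cong (λ z → suc (triangle Q + z)) (m≤n⇒m⊓n≡m (<⇒≤ R<Q)) ⟨
    suc (triangle Q + R ⊓ Q)   ≡⟨ cong suc (σ-in-block m (m<n⇒m<1+n Q<n0)) ⟨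
    suc (σ m)                  ∎)
    where
    open ≡-Reasoning
    Q = m / n
    R = m % n
    Q<n0 = ≰⇒> n0≰Q
    m<end : m < Q * n + suc R
    m<end = subst (m <_) (sym (+-suc (Q * n) R)) (s≤s (≤-reflexive (quot-rem m)))
  ...   | no R≮Q = suc Q , 0 , ≤-trans Q<n0 (n≤1+n n0) , m<end , (begin
    triangle (suc Q) + 0       ≡⟨ +-identityʳ _ ⟩
    suc (Q + triangle Q)       ≡⟨ cong suc (+-comm Q (triangle Q)) ⟩
    suc (triangle Q + Q)       ≡⟨ cong (λ z → suc (triangle Q + z)) (m≥n⇒m⊓n≡n (≮⇒≥ R≮Q)) ⟨
    suc (triangle Q + R ⊓ Q)   ≡⟨ cong suc (σ-in-block m (m<n⇒m<1+n Q<n0)) ⟨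
    suc (σ m)                  ∎)
    where
    open ≡-Reasoning
    Q = m / n
    R = m % n
    Q<n0 = ≰⇒> n0≰Q
    m<end : m < suc Q * n + 0
    m<end = subst₂ _<_ (sym (quot-rem m)) (trans (+-comm (Q * n) n) (sym (+-identityʳ _)))
                        (+-monoʳ-< (Q * n) (m%n<n m n))

  residue carry : (Fin n → ℕ) → Fin n → ℕ
  residue e i = e i % suc n
  carry   e i = e i / suc n

  residue≤n : ∀ e i → residue e i ≤ n
  residue≤n e i = s≤s⁻¹ (m%n<n (e i) (suc n))

  certificate-at-level : ∀ m e₀ (e : Fin n → ℕ) → e₀ + sum e ≡ σ m → ∀ u →
    u + countAbove (residue e) u ≤ n →
    triangle (u + countAbove (residue e) u) + countAbove (residue e) u ≤ sum (residue e) →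
    Σ (Fin n → ℕ) λ g → e₀ + sum g ≤ m × (∀ i → e i + sum g ≤ suc n * g i)
  certificate-at-level m e₀ e deg≡σ u u+δ≤n fits = g , at-P , at-i
    where
    N = suc n
    a b : Fin n → ℕ
    a = carry e
    b = residue e
    δ = countAbove b u
    A = sum a
    g : Fin n → ℕ
    g i = u + ⟦ u < b i ⟧ + a i + (δ + A)

    e≡ : ∀ i → e i ≡ b i + N * a i
    e≡ i = trans (m≡m%n+[m/n]*n (e i) N) (cong (b i +_) (*-comm (a i) N))

    sum-e : sum e ≡ sum b + N * A
    sum-e = trans (sum-cong-≗ e≡)
      (trans (∑-distrib-+ b (λ i → N * a i)) (cong (sum b +_) (sym (*-distribˡ-sum N a))))

    sum-g : sum g ≡ n * u + N * (δ + A)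
    sum-g = begin
      sum g
        ≡⟨ ∑-distrib-+ {n} (λ i → u + ⟦ u < b i ⟧ + a i) (λ _ → δ + A) ⟩
      sum {n} (λ i → u + ⟦ u < b i ⟧ + a i) + sum {n} (λ _ → δ + A)
        ≡⟨ cong (_+ sum {n} (λ _ → δ + A)) (∑-distrib-+ {n} (λ i → u + ⟦ u < b i ⟧) a) ⟩
      sum {n} (λ i → u + ⟦ u < b i ⟧) + A + sum {n} (λ _ → δ + A)
        ≡⟨ cong (λ z → z + A + sum {n} (λ _ → δ + A)) (∑-distrib-+ {n} (λ _ → u) (λ i → ⟦ u < b i ⟧)) ⟩
      sum {n} (λ _ → u) + δ + A + sum {n} (λ _ → δ + A)
        ≡⟨ cong₂ (λ x y → x + δ + A + y) (sum-const n u) (sum-const n (δ + A)) ⟩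
      n * u + δ + A + n * (δ + A)
        ≡⟨ regroup n u δ A ⟩
      n * u + N * (δ + A)
        ∎
      where
      open ≡-Reasoning
      regroup : ∀ n u δ A → n * u + δ + A + n * (δ + A) ≡ n * u + suc n * (δ + A)
      regroup = solve-∀

    at-P : e₀ + sum g ≤ m
    at-P with σ-staircase (u + δ) δ (m≤n+m δ u) u+δ≤n
    ... | σT≡ , χT≡1 = subst (_≤ m) (trans (regroup u δ e₀ A n) (cong (e₀ +_) (sym sum-g)))
                              (σ-budget T (e₀ + N * A) m χT≡1 fits′)
      where
      T = (u + δ) * n + δ
      regroup : ∀ u δ e₀ A n → (u + δ) * n + δ + (e₀ + suc n * A) ≡ e₀ + (n * u + suc n * (δ + A))
      regroup = solve-∀
      fits′ : σ T + (e₀ + N * A) ≤ σ m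
      fits′ = begin
        σ T + (e₀ + N * A)                ≡⟨ cong (_+ (e₀ + N * A)) σT≡ ⟩
        triangle (u + δ) + δ + (e₀ + N * A) ≤⟨ +-monoˡ-≤ (e₀ + N * A) fits ⟩
        sum b + (e₀ + N * A)              ≡⟨ swap (sum b) e₀ (N * A) ⟩
        e₀ + (sum b + N * A)              ≡⟨ cong (e₀ +_) sum-e ⟨
        e₀ + sum e                        ≡⟨ deg≡σ ⟩
        σ m                               ∎
        where
        open ≤-Reasoning
        swap : ∀ x y z → x + (y + z) ≡ y + (x + z)
        swap = solve-∀

    at-i : ∀ i → e i + sum g ≤ N * g i
    at-i i = subst₂ _≤_ (sym lhs) (sym rhs)
      (+-monoʳ-≤ (N * a i + n * u + N * (δ + A)) (⟦<⟧-bound u (residue≤n e i)))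
      where
      lhs : e i + sum g ≡ N * a i + n * u + N * (δ + A) + b i
      lhs = trans (cong₂ _+_ (e≡ i) sum-g) (regroup (b i) (N * a i) (n * u) (N * (δ + A)))
        where
        regroup : ∀ x y z w → x + y + (z + w) ≡ y + z + w + x
        regroup = solve-∀
      rhs : N * g i ≡ N * a i + n * u + N * (δ + A) + (u + N * ⟦ u < b i ⟧)
      rhs = regroup u ⟦ u < b i ⟧ (a i) (δ + A) n
        where
        regroup : ∀ u c a d n →
          suc n * (u + c + a + d) ≡ suc n * a + n * u + suc n * d + (u + suc n * c)
        regroup = solve-∀

  lower-certificate : ∀ m e₀ (e : Fin n → ℕ) → e₀ + sum e ≡ σ m →
    Σ (Fin n → ℕ) λ g → e₀ + sum g ≤ m × (∀ i → e i + sum g ≤ suc n * g i)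
  lower-certificate m e₀ e deg≡σ =
    let u , u+δ≤n , fits = staircase-bound (residue e) (residue≤n e)
    in certificate-at-level m e₀ e deg≡σ u u+δ≤n fits

module Divisors where

  open import Data.Nat as ℕ using (ℕ; zero; suc)
  import Data.Nat.Properties as ℕ
  open import Data.Integer using (ℤ; +_; 0ℤ; 1ℤ; -1ℤ; _+_; _-_; _*_; -_; ∣_∣; _≤_; _<_; +≤+)
  open import Data.Integer.Properties hiding (_≟_)
  open import Data.Integer.Tactic.RingSolver using (solve-∀)
  open import Data.Fin using (Fin; zero; suc; toℕ; punchIn; punchOut; _≟_)
  open import Data.Fin.Properties using (punchIn-punchOut; punchInᵢ≢i; toℕ<n)
  open import Data.Vec.Functional using (insertAt)
  open import Data.Vec.Functional.Properties using (insertAt-lookup; insertAt-punchIn)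
  import Data.List as List
  open import Data.List.Properties using (map-tabulate)
  open import Data.Bool using (if_then_else_)
  open import Data.Product using (Σ; ∃; _×_; _,_)
  open import Data.Sum using (inj₁; inj₂)
  open import Data.Empty using (⊥-elim)
  open import Function using (_∘_; id)
  open import Relation.Nullary using (yes; no; does; ¬_)
  open import Relation.Nullary.Decidable using (dec-true; dec-false)
  open import Relation.Binary.Definitions using (tri<; tri≈; tri>)
  open import Relation.Binary.PropositionalEquality
  open LayerCake using (⟦_<_⟧; ⟦<⟧-true; ⟦<⟧-false; ∑<-⟦<⟧)
  open import Algebra.Properties.Semiring.Sum +-*-semiring
    using (sum; sum-cong-≗; sum-remove; ∑-distrib-+)
  import Algebra.Properties.Semiring.Sum ℕ.+-*-semiring as ℕΣ

  ≤-by-difference : ∀ {x y x′ y′} → y - x ≡ y′ - x′ → x ≤ y → x′ ≤ y′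
  ≤-by-difference eq x≤y = 0≤i-j⇒j≤i (subst (0ℤ ≤_) eq (i≤j⇒0≤j-i x≤y))

  pos-m+n≤o⇒n≤o-m : ∀ {a b c} → a ℕ.+ b ℕ.≤ c → + b ≤ + c - + a
  pos-m+n≤o⇒n≤o-m {a} {b} {c} a+b≤c = ≤-by-difference
    (trans (cong (_-_ (+ c)) (pos-+ a b)) (regroup (+ a) (+ b) (+ c))) (+≤+ a+b≤c)
    where
    regroup : ∀ a b c → c - (a + b) ≡ c - a - b
    regroup = solve-∀

  pos-n≤o-m⇒m+n≤o : ∀ {a b c} → + b ≤ + c - + a → a ℕ.+ b ℕ.≤ c
  pos-n≤o-m⇒m+n≤o {a} {b} {c} b≤c-a = drop‿+≤+ (≤-by-difference
    (trans (regroup (+ a) (+ b) (+ c)) (cong (_-_ (+ c)) (sym (pos-+ a b)))) b≤c-a)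
    where
    regroup : ∀ a b c → c - a - b ≡ c - (a + b)
    regroup = solve-∀

  foldr-tabulate : ∀ {k} (g : Fin k → ℤ) → List.foldr _+_ 0ℤ (List.tabulate g) ≡ sum g
  foldr-tabulate {zero}  g = refl
  foldr-tabulate {suc k} g = cong (_+_ (g zero)) (foldr-tabulate (g ∘ suc))

  Σv≡sum : ∀ G (g : Fin (V G) → ℤ) → Σv G g ≡ sum g
  Σv≡sum G g = trans (cong (List.foldr _+_ 0ℤ) (map-tabulate id g)) (foldr-tabulate g)

  sum-const : ∀ k c → sum {k} (λ _ → c) ≡ + k * c
  sum-const zero    c = sym (*-zeroˡ c)
  sum-const (suc k) c = trans (cong (_+_ c) (sum-const k c)) (sym (suc-* (+ k) c))

  sum-neg : ∀ {k} (g : Fin k → ℤ) → sum (λ i → - g i) ≡ - sum g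
  sum-neg {zero}  g = refl
  sum-neg {suc k} g = trans (cong (_+_ (- g zero)) (sum-neg (g ∘ suc)))
                            (sym (neg-distrib-+ (g zero) (sum (g ∘ suc))))

  sum-pos : ∀ {k} (g : Fin k → ℕ) → sum (λ i → + g i) ≡ + ℕΣ.sum g
  sum-pos {zero}  g = refl
  sum-pos {suc k} g = trans (cong (_+_ (+ g zero)) (sum-pos (g ∘ suc))) (sym (pos-+ (g zero) _))

  sum-mono-≤ : ∀ {k} {g h : Fin k → ℤ} → (∀ i → g i ≤ h i) → sum g ≤ sum h
  sum-mono-≤ {zero}  g≤h = ≤-refl
  sum-mono-≤ {suc k} g≤h = +-mono-≤ (g≤h zero) (sum-mono-≤ (g≤h ∘ suc))

  sum-insertAt : ∀ {k} (g : Fin k → ℤ) P x → sum (insertAt g P x) ≡ x + sum g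
  sum-insertAt g P x = trans (sum-remove {i = P} (insertAt g P x))
    (cong₂ _+_ (insertAt-lookup g P x) (sum-cong-≗ (insertAt-punchIn g P x)))

  data PunchInView {k} (P : Fin (suc k)) : Fin (suc k) → Set where
    at   : PunchInView P P
    away : ∀ i → PunchInView P (punchIn P i)

  punchInView : ∀ {k} (P Q : Fin (suc k)) → PunchInView P Q
  punchInView P Q with P ≟ Q
  ... | yes refl = at
  ... | no P≢Q   = subst (PunchInView P) (punchIn-punchOut P≢Q) (away (punchOut P≢Q))

  first-minimiser : ∀ {k} (g : Fin (suc k) → ℤ) → Σ (Fin (suc k)) λ i₀ →
    (∀ i → g i₀ ≤ g i) × (∀ i → toℕ i ℕ.< toℕ i₀ → g i₀ < g i)
  first-minimiser {zero}  g = zero , (λ { zero → ≤-refl }) , (λ { zero () })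
  first-minimiser {suc k} g with first-minimiser (g ∘ suc)
  ... | j , minimal , first with g zero ≤? g (suc j)
  ...   | yes g0≤gj = zero , minimal′ , (λ _ ())
    where
    minimal′ : ∀ i → g zero ≤ g i
    minimal′ zero    = ≤-refl
    minimal′ (suc i) = ≤-trans g0≤gj (minimal i)
  ...   | no g0≰gj = suc j , minimal′ , first′
    where
    minimal′ : ∀ i → g (suc j) ≤ g i
    minimal′ zero    = <⇒≤ (≰⇒> g0≰gj)
    minimal′ (suc i) = minimal i
    first′ : ∀ i → toℕ i ℕ.< toℕ (suc j) → g (suc j) < g i
    first′ zero    _   = ≰⇒> g0≰gj
    first′ (suc i) i<j = first i (ℕ.s≤s⁻¹ i<j)

  -- At the first minimum μ = h i₀ one has k μ + i₀ ≤ sum h ≤ (k + 1) μ + i₀, so μ ≥ 0.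
  sum-nonneg-if-bounded-by-entries : ∀ {k} (h : Fin k → ℤ) →
    (∀ i → sum h ≤ + suc k * h i + + toℕ i) → 0ℤ ≤ sum h
  sum-nonneg-if-bounded-by-entries {zero}  h _       = ≤-refl
  sum-nonneg-if-bounded-by-entries {suc k} h bounded with first-minimiser h
  ... | i₀ , minimal , first = ≤-trans (+-mono-≤ nμ≥0 (+≤+ ℕ.z≤n)) below
    where
    μ = h i₀
    ι = toℕ i₀

    step : ∀ i → μ + + ⟦ toℕ i < ι ⟧ ≤ h i
    step i with toℕ i ℕ.<? ι
    ... | yes i<ι = subst (λ c → μ + + c ≤ h i) (sym (⟦<⟧-true i<ι))
                      (subst (_≤ h i) (+-comm 1ℤ μ) (i<j⇒suc[i]≤j (first i i<ι)))
    ... | no i≮ι  = subst (λ c → μ + + c ≤ h i) (sym (⟦<⟧-false (ℕ.≮⇒≥ i≮ι)))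
                      (subst (_≤ h i) (sym (+-identityʳ μ)) (minimal i))

    below : + suc k * μ + + ι ≤ sum h
    below = subst (_≤ sum h) count (sum-mono-≤ {suc k} step)
      where
      count : sum {suc k} (λ i → μ + + ⟦ toℕ i < ι ⟧) ≡ + suc k * μ + + ι
      count = trans (∑-distrib-+ {suc k} (λ _ → μ) (λ i → + ⟦ toℕ i < ι ⟧))
        (cong₂ _+_ (sum-const (suc k) μ)
          (trans (sum-pos {suc k} (λ i → ⟦ toℕ i < ι ⟧))
            (cong +_ (trans (∑<-⟦<⟧ (suc k) ι) (ℕ.m≤n⇒m⊓n≡m (ℕ.<⇒≤ (toℕ<n i₀)))))))

    μ≥0 : 0ℤ ≤ μ
    μ≥0 = ≤-by-difference (difference (+ suc k) μ (+ ι)) (≤-trans below (bounded i₀))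
      where
      difference : ∀ N μ ι → (1ℤ + N) * μ + ι - (N * μ + ι) ≡ μ - 0ℤ
      difference = solve-∀

    nμ≥0 : 0ℤ ≤ + suc k * μ
    nμ≥0 = subst (_≤ + suc k * μ) (*-zeroʳ (+ suc k)) (*-monoˡ-≤-nonNeg (+ suc k) μ≥0)

  module _ (G : Graph) where

    linSys-intro : ∀ D (f : Fin (V G) → ℤ) → (∀ Q → 0ℤ ≤ D Q + Δ G f Q) → LinSysNonempty G D
    linSys-intro D f D+Δf≥0 = (λ Q → D Q + Δ G f Q) , D+Δf≥0 , f , λ Q → cancel (D Q) (Δ G f Q)
      where
      cancel : ∀ d x → d + x - d ≡ x
      cancel = solve-∀

    linSys-elim : ∀ D → LinSysNonempty G D → ∃ λ f → ∀ Q → 0ℤ ≤ D Q + Δ G f Q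
    linSys-elim D (E , E≥0 , f , E-D≡Δf) = f , λ Q →
      subst (0ℤ ≤_) (trans (split (E Q) (D Q)) (cong (_+_ (D Q)) (E-D≡Δf Q))) (E≥0 Q)
      where
      split : ∀ e d → e ≡ d + (e - d)
      split = solve-∀

    linSys-mono : ∀ D₁ D₂ → (∀ Q → D₁ Q ≤ D₂ Q) → LinSysNonempty G D₁ → LinSysNonempty G D₂
    linSys-mono D₁ D₂ D₁≤D₂ nonempty with linSys-elim D₁ nonempty
    ... | f , ok = linSys-intro D₂ f (λ Q → ≤-trans (ok Q) (+-monoˡ-≤ (Δ G f Q) (D₁≤D₂ Q)))

    Δ-const : ∀ c Q → Δ G (λ _ → c) Q ≡ 0ℤ
    Δ-const c Q = begin
      Δ G (λ _ → c) Q                           ≡⟨ Σv≡sum G (λ R → + adj G Q R * (c - c)) ⟩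
      sum {V G} (λ R → + adj G Q R * (c - c))   ≡⟨ sum-cong-≗ no-slope ⟩
      sum {V G} (λ _ → 0ℤ)                      ≡⟨ sum-const (V G) 0ℤ ⟩
      + V G * 0ℤ                                ≡⟨ *-zeroʳ (+ V G) ⟩
      0ℤ                                        ∎
      where
      open ≡-Reasoning
      no-slope : ∀ R → + adj G Q R * (c - c) ≡ 0ℤ
      no-slope R = trans (cong (_*_ (+ adj G Q R)) (+-inverseʳ c)) (*-zeroʳ (+ adj G Q R))

    effective⇒linSys : ∀ D → Effective G D → LinSysNonempty G D
    effective⇒linSys D D≥0 = linSys-intro D (λ _ → 0ℤ) λ Q →
      subst (0ℤ ≤_) (sym (trans (cong (_+_ (D Q)) (Δ-const 0ℤ Q)) (+-identityʳ (D Q)))) (D≥0 Q)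

    hasRank-functional : ∀ D {r r′} → HasRank G D r → HasRank G D r′ → r ≡ r′
    hasRank-functional D (inj₁ (r≡ , _))              (inj₁ (r′≡ , _))            = trans r≡ (sym r′≡)
    hasRank-functional D (inj₁ (_ , empty))           (inj₂ (_ , _ , nonempty , _)) = ⊥-elim (empty nonempty)
    hasRank-functional D (inj₂ (_ , _ , nonempty , _)) (inj₁ (_ , empty))          = ⊥-elim (empty nonempty)
    hasRank-functional D (inj₂ (k , r≡ , _ , rk , maxk)) (inj₂ (k′ , r′≡ , _ , rk′ , maxk′))
      with ℕ.<-cmp k k′
    ... | tri< k<k′ _ _ = ⊥-elim (maxk k′ k<k′ rk′)
    ... | tri≈ _ refl _ = trans r≡ (sym r′≡)
    ... | tri> _ _ k′<k = ⊥-elim (maxk′ k k′<k rk)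

    ·-at : ∀ c P → _·_ {G} c P P ≡ c
    ·-at c P rewrite dec-true (P ≟ P) refl = refl

    ·-away : ∀ c {P Q} → P ≢ Q → _·_ {G} c P Q ≡ 0ℤ
    ·-away c {P} {Q} P≢Q rewrite dec-false (P ≟ Q) P≢Q = refl

    ·-effective : ∀ {c} → 0ℤ ≤ c → ∀ P → Effective G (_·_ {G} c P)
    ·-effective c≥0 P Q with P ≟ Q
    ... | yes _ = c≥0
    ... | no _  = ≤-refl

    deg-· : ∀ c P → deg G (_·_ {G} c P) ≡ c
    deg-· c P = trans (Σv≡sum G _) (sum-point P)
      where
      sum-point : ∀ {k} (P : Fin k) → sum (λ Q → if does (P ≟ Q) then c else 0ℤ) ≡ c
      sum-point {suc k} P = begin
        sum point                    ≡⟨ sum-remove {i = P} point ⟩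
        point P + sum (point ∘ punchIn P)
          ≡⟨ cong₂ _+_ (cong (λ b → if b then c else 0ℤ) (dec-true (P ≟ P) refl)) (sum-cong-≗ elsewhere) ⟩
        c + sum {k} (λ _ → 0ℤ)       ≡⟨ cong (_+_ c) (trans (sum-const k 0ℤ) (*-zeroʳ (+ k))) ⟩
        c + 0ℤ                       ≡⟨ +-identityʳ c ⟩
        c                            ∎
        where
        open ≡-Reasoning
        point : Fin (suc k) → ℤ
        point Q = if does (P ≟ Q) then c else 0ℤ
        elsewhere : ∀ i → point (punchIn P i) ≡ 0ℤ
        elsewhere i = cong (λ b → if b then c else 0ℤ) (dec-false (P ≟ punchIn P i) (punchInᵢ≢i P i ∘ sym))

    RankCond-antitone : ∀ (P : Fin (V G)) D {k k′} → k ℕ.≤ k′ → RankCond G D k′ → RankCond G D k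
    RankCond-antitone P D {k} {k′} k≤k′ rank′ E E≥0 degE =
      linSys-mono (_⊖_ {G} D E′) (_⊖_ {G} D E) smaller (rank′ E′ E′≥0 degE′)
      where
      X = _·_ {G} (+ (k′ ℕ.∸ k)) P
      E′ = _⊕_ {G} E X
      X≥0 : Effective G X
      X≥0 = ·-effective (+≤+ ℕ.z≤n) P
      E′≥0 : Effective G E′
      E′≥0 Q = +-mono-≤ (E≥0 Q) (X≥0 Q)
      degE′ : deg G E′ ≡ + k′
      degE′ = begin
        deg G E′                 ≡⟨ Σv≡sum G E′ ⟩
        sum E′                   ≡⟨ ∑-distrib-+ E X ⟩
        sum E + sum X
          ≡⟨ cong₂ _+_ (trans (sym (Σv≡sum G E)) degE) (trans (sym (Σv≡sum G X)) (deg-· _ P)) ⟩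
        + k + + (k′ ℕ.∸ k)       ≡⟨ pos-+ k _ ⟨
        + (k ℕ.+ (k′ ℕ.∸ k))     ≡⟨ cong +_ (ℕ.m+[n∸m]≡n k≤k′) ⟩
        + k′                     ∎
        where open ≡-Reasoning
      smaller : ∀ Q → (_⊖_ {G} D E′) Q ≤ (_⊖_ {G} D E) Q
      smaller Q = ≤-by-difference (difference (D Q) (E Q) (X Q)) (X≥0 Q)
        where
        difference : ∀ d e x → x - 0ℤ ≡ d - e - (d - (e + x))
        difference = solve-∀

  module CompleteGraph (n : ℕ) (P : Fin (suc n)) where

    Kₙ₊₁ : Graph
    Kₙ₊₁ = K (suc n)

    N≡1+n : + suc n ≡ 1ℤ + + n
    N≡1+n = pos-+ 1 n

    Δ-K : ∀ f Q → Δ Kₙ₊₁ f Q ≡ + suc n * f Q - sum f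
    Δ-K f Q = begin
      Δ Kₙ₊₁ f Q                                         ≡⟨ Σv≡sum Kₙ₊₁ slope ⟩
      sum slope                                          ≡⟨ sum-cong-≗ edge ⟩
      sum (λ R → f Q + - f R)                            ≡⟨ ∑-distrib-+ (λ _ → f Q) (λ R → - f R) ⟩
      sum {suc n} (λ _ → f Q) + sum (λ R → - f R)        ≡⟨ cong₂ _+_ (sum-const (suc n) (f Q)) (sum-neg f) ⟩
      + suc n * f Q - sum f                              ∎
      where
      open ≡-Reasoning
      slope : Fin (suc n) → ℤ
      slope R = + adj Kₙ₊₁ Q R * (f Q - f R)
      edge : ∀ R → slope R ≡ f Q + - f R
      edge R with Q ≟ R
      ... | yes refl = sym (+-inverseʳ (f Q))
      ... | no _     = *-identityˡ _

    -- h i stands for f (punchIn P i) - f P - c, where f is the potential.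
    linSys-K-intro : ∀ D c (h : Fin n → ℤ) → sum h + + n * c ≤ D P →
      (∀ i → sum h ≤ + suc n * h i + c + D (punchIn P i)) → LinSysNonempty Kₙ₊₁ D
    linSys-K-intro D c h at-P at-i = linSys-intro Kₙ₊₁ D f nonneg
      where
      f : Fin (suc n) → ℤ
      f = insertAt (λ i → h i + c) P 0ℤ
      sum-f : sum f ≡ sum h + + n * c
      sum-f = begin
        sum f                              ≡⟨ sum-insertAt (λ i → h i + c) P 0ℤ ⟩
        0ℤ + sum (λ i → h i + c)           ≡⟨ +-identityˡ _ ⟩
        sum (λ i → h i + c)                ≡⟨ ∑-distrib-+ h (λ _ → c) ⟩
        sum h + sum {n} (λ _ → c)          ≡⟨ cong (_+_ (sum h)) (sum-const n c) ⟩
        sum h + + n * c                    ∎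
        where open ≡-Reasoning
      nonneg : ∀ Q → 0ℤ ≤ D Q + Δ Kₙ₊₁ f Q
      nonneg Q rewrite Δ-K f Q | sum-f | N≡1+n with punchInView P Q
      ... | at rewrite insertAt-lookup (λ i → h i + c) P 0ℤ =
        ≤-by-difference (difference (D P) (sum h) (+ n) c) at-P
        where
        difference : ∀ d s n c → d - (s + n * c) ≡ d + ((1ℤ + n) * 0ℤ - (s + n * c)) - 0ℤ
        difference = solve-∀
      ... | away i rewrite insertAt-punchIn (λ i → h i + c) P 0ℤ i =
        ≤-by-difference (difference (D (punchIn P i)) (sum h) (h i) (+ n) c)
          (subst (λ N → sum h ≤ N * h i + c + D (punchIn P i)) N≡1+n (at-i i))
        where
        difference : ∀ d s x n c →
          (1ℤ + n) * x + c + d - s ≡ d + ((1ℤ + n) * (x + c) - (s + n * c)) - 0ℤ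
        difference = solve-∀

    linSys-K-elim : ∀ D → LinSysNonempty Kₙ₊₁ D → ∀ c → Σ (Fin n → ℤ) λ h →
      sum h + + n * c ≤ D P × (∀ i → sum h ≤ + suc n * h i + c + D (punchIn P i))
    linSys-K-elim D nonempty c with linSys-elim Kₙ₊₁ D nonempty
    ... | f , ok = h , at-P , at-i
      where
      φ : Fin n → ℤ
      φ = f ∘ punchIn P
      h : Fin n → ℤ
      h i = φ i + - (f P + c)
      sum-f : sum f ≡ f P + sum φ
      sum-f = sum-remove {i = P} f
      sum-h : sum h ≡ sum φ + + n * - (f P + c)
      sum-h = trans (∑-distrib-+ φ (λ _ → - (f P + c))) (cong (_+_ (sum φ)) (sum-const n _))
      ok′ : ∀ Q → 0ℤ ≤ D Q + ((1ℤ + + n) * f Q - (f P + sum φ))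
      ok′ Q = subst (λ x → 0ℤ ≤ D Q + x)
        (trans (Δ-K f Q) (cong₂ (λ N s → N * f Q - s) N≡1+n sum-f)) (ok Q)
      at-P : sum h + + n * c ≤ D P
      at-P = ≤-by-difference (begin
        D P + ((1ℤ + + n) * f P - (f P + sum φ)) - 0ℤ        ≡⟨ difference (D P) (f P) (sum φ) (+ n) c ⟩
        D P - (sum φ + + n * - (f P + c) + + n * c)          ≡⟨ cong (λ s → D P - (s + + n * c)) sum-h ⟨
        D P - (sum h + + n * c)                              ∎) (ok′ P)
        where
        open ≡-Reasoning
        difference : ∀ d p s n c →
          d + ((1ℤ + n) * p - (p + s)) - 0ℤ ≡ d - (s + n * - (p + c) + n * c)
        difference = solve-∀
      at-i : ∀ i → sum h ≤ + suc n * h i + c + D (punchIn P i)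
      at-i i = ≤-by-difference (begin
        D (punchIn P i) + ((1ℤ + + n) * φ i - (f P + sum φ)) - 0ℤ
          ≡⟨ difference (D (punchIn P i)) (f P) (φ i) (sum φ) (+ n) c ⟩
        (1ℤ + + n) * h i + c + D (punchIn P i) - (sum φ + + n * - (f P + c))
          ≡⟨ cong₂ (λ N s → N * h i + c + D (punchIn P i) - s) (sym N≡1+n) (sym sum-h) ⟩
        + suc n * h i + c + D (punchIn P i) - sum h
          ∎) (ok′ (punchIn P i))
        where
        open ≡-Reasoning
        difference : ∀ d p x s n c →
          d + ((1ℤ + n) * x - (p + s)) - 0ℤ ≡ (1ℤ + n) * (x + - (p + c)) + c + d - (s + n * - (p + c))
        difference = solve-∀

    linSys-K-bound : ∀ D → LinSysNonempty Kₙ₊₁ D → ∀ c →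
      (∀ i → c + D (punchIn P i) ≤ + toℕ i) → + n * c ≤ D P
    linSys-K-bound D nonempty c small with linSys-K-elim D nonempty c
    ... | h , at-P , at-i =
      ≤-trans (subst (_≤ sum h + + n * c) (+-identityˡ _) (+-monoˡ-≤ (+ n * c) sum-h≥0)) at-P
      where
      sum-h≥0 : 0ℤ ≤ sum h
      sum-h≥0 = sum-nonneg-if-bounded-by-entries h λ i →
        ≤-trans (at-i i) (subst (_≤ + suc n * h i + + toℕ i) (sym (+-assoc (+ suc n * h i) c _))
                                (+-monoʳ-≤ (+ suc n * h i) (small i)))

  module RankOnK (n0 : ℕ) (P : Fin (suc (suc n0))) where
    open NumericalSemigroup n0 using (n; σ; next-staircase; lower-certificate)
    open CompleteGraph n P
    open LayerCake using (triangle; ∑<-∸)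

    _·P : ℤ → Divisor Kₙ₊₁
    c ·P = _·_ {Kₙ₊₁} c P

    effective-coefficients : ∀ E → Effective Kₙ₊₁ E →
      deg Kₙ₊₁ E ≡ + (∣ E P ∣ ℕ.+ ℕΣ.sum (λ i → ∣ E (punchIn P i) ∣))
    effective-coefficients E E≥0 = begin
      deg Kₙ₊₁ E                                      ≡⟨ Σv≡sum Kₙ₊₁ E ⟩
      sum E                                           ≡⟨ sum-remove {i = P} E ⟩
      E P + sum (E ∘ punchIn P)                       ≡⟨ cong₂ _+_ (0≤i⇒+∣i∣≡i (E≥0 P)) (sum-cong-≗ (0≤i⇒+∣i∣≡i ∘ E≥0 ∘ punchIn P)) ⟨
      + ∣ E P ∣ + sum (λ i → + ∣ E (punchIn P i) ∣)   ≡⟨ cong (_+_ (+ ∣ E P ∣)) (sum-pos (λ i → ∣ E (punchIn P i) ∣)) ⟩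
      + ∣ E P ∣ + + ℕΣ.sum (λ i → ∣ E (punchIn P i) ∣) ≡⟨ pos-+ ∣ E P ∣ _ ⟨
      + (∣ E P ∣ ℕ.+ ℕΣ.sum (λ i → ∣ E (punchIn P i) ∣)) ∎
      where open ≡-Reasoning

    linSys-mP-E-intro : ∀ m E → Effective Kₙ₊₁ E → (g : Fin n → ℕ) →
      ∣ E P ∣ ℕ.+ ℕΣ.sum g ℕ.≤ m → (∀ i → ∣ E (punchIn P i) ∣ ℕ.+ ℕΣ.sum g ℕ.≤ suc n ℕ.* g i) →
      LinSysNonempty Kₙ₊₁ (_⊖_ {Kₙ₊₁} ((+ m) ·P) E)
    linSys-mP-E-intro m E E≥0 g g-at-P g-at-i = linSys-K-intro D 0ℤ (λ i → + g i) at-P at-i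
      where
      D = _⊖_ {Kₙ₊₁} ((+ m) ·P) E
      e : Fin n → ℕ
      e i = ∣ E (punchIn P i) ∣

      at-P : sum (λ i → + g i) + + n * 0ℤ ≤ D P
      at-P = subst₂ _≤_ (sym lhs) (sym rhs) (pos-m+n≤o⇒n≤o-m {∣ E P ∣} g-at-P)
        where
        lhs : sum (λ i → + g i) + + n * 0ℤ ≡ + ℕΣ.sum g
        lhs = trans (cong₂ _+_ (sum-pos g) (*-zeroʳ (+ n))) (+-identityʳ _)
        rhs : D P ≡ + m - + ∣ E P ∣
        rhs = cong₂ _-_ (·-at Kₙ₊₁ (+ m) P) (sym (0≤i⇒+∣i∣≡i (E≥0 P)))

      at-i : ∀ i → sum (λ i → + g i) ≤ + suc n * + g i + 0ℤ + D (punchIn P i)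
      at-i i = subst₂ _≤_ (sym (sum-pos g)) (sym rhs) (pos-m+n≤o⇒n≤o-m {e i} (g-at-i i))
        where
        rhs : + suc n * + g i + 0ℤ + D (punchIn P i) ≡ + (suc n ℕ.* g i) - + e i
        rhs = begin
          + suc n * + g i + 0ℤ + D (punchIn P i)
            ≡⟨ cong₂ (λ x y → x + 0ℤ + (y - E (punchIn P i)))
                     (sym (pos-* (suc n) (g i))) (·-away Kₙ₊₁ (+ m) (punchInᵢ≢i P i ∘ sym)) ⟩
          + (suc n ℕ.* g i) + 0ℤ + (0ℤ - E (punchIn P i))
            ≡⟨ cong (λ x → + (suc n ℕ.* g i) + 0ℤ + (0ℤ - x)) (sym (0≤i⇒+∣i∣≡i (E≥0 (punchIn P i)))) ⟩
          + (suc n ℕ.* g i) + 0ℤ + (0ℤ - + e i)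
            ≡⟨ simplify (+ (suc n ℕ.* g i)) (+ e i) ⟩
          + (suc n ℕ.* g i) - + e i
            ∎
          where
          open ≡-Reasoning
          simplify : ∀ x y → x + 0ℤ + (0ℤ - y) ≡ x - y
          simplify = solve-∀

    rankCond-σ : ∀ m → RankCond Kₙ₊₁ ((+ m) ·P) (σ m)
    rankCond-σ m E E≥0 degE =
      let g , g-at-P , g-at-i = lower-certificate m ∣ E P ∣ (λ i → ∣ E (punchIn P i) ∣)
                                  (+-injective (trans (sym (effective-coefficients E E≥0)) degE))
      in linSys-mP-E-intro m E E≥0 g g-at-P g-at-i

    staircase : ℕ → ℕ → Divisor Kₙ₊₁
    staircase q j = insertAt (λ i → + (q ℕ.∸ toℕ i)) P (+ j)

    staircase-effective : ∀ q j → Effective Kₙ₊₁ (staircase q j)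
    staircase-effective q j Q with punchInView P Q
    ... | at     = subst (0ℤ ≤_) (sym (insertAt-lookup _ P (+ j))) (+≤+ ℕ.z≤n)
    ... | away i = subst (0ℤ ≤_) (sym (insertAt-punchIn _ P (+ j) i)) (+≤+ ℕ.z≤n)

    deg-staircase : ∀ {q} j → q ℕ.≤ n → deg Kₙ₊₁ (staircase q j) ≡ + (triangle q ℕ.+ j)
    deg-staircase {q} j q≤n = begin
      deg Kₙ₊₁ (staircase q j)           ≡⟨ Σv≡sum Kₙ₊₁ (staircase q j) ⟩
      sum (staircase q j)                ≡⟨ sum-insertAt (λ i → + (q ℕ.∸ toℕ i)) P (+ j) ⟩
      + j + sum {n} (λ i → + (q ℕ.∸ toℕ i)) ≡⟨ cong (_+_ (+ j)) (trans (sum-pos {n} (λ i → q ℕ.∸ toℕ i)) (cong +_ (∑<-∸ q q≤n))) ⟩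
      + j + + triangle q                 ≡⟨ pos-+ j (triangle q) ⟨
      + (j ℕ.+ triangle q)               ≡⟨ cong +_ (ℕ.+-comm j (triangle q)) ⟩
      + (triangle q ℕ.+ j)               ∎
      where open ≡-Reasoning

    ¬rankCond-suc-σ : ∀ m → ¬ RankCond Kₙ₊₁ ((+ m) ·P) (suc (σ m))
    ¬rankCond-suc-σ m rank with next-staircase m
    ... | q , j , q≤n , m<qn+j , staircase≡ = ℕ.<⇒≱ m<qn+j qn+j≤m
      where
      E = staircase q j
      D = _⊖_ {Kₙ₊₁} ((+ m) ·P) E

      small : ∀ i → + q + D (punchIn P i) ≤ + toℕ i
      small i = ≤-by-difference difference (+≤+ (ℕ.m≤n+m∸n q (toℕ i)))
        where
        s = q ℕ.∸ toℕ i
        D≡ : D (punchIn P i) ≡ 0ℤ - + s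
        D≡ = cong₂ _-_ (·-away Kₙ₊₁ (+ m) (punchInᵢ≢i P i ∘ sym)) (insertAt-punchIn _ P (+ j) i)
        difference : + (toℕ i ℕ.+ s) - + q ≡ + toℕ i - (+ q + D (punchIn P i))
        difference = begin
          + (toℕ i ℕ.+ s) - + q              ≡⟨ cong (_- + q) (pos-+ (toℕ i) s) ⟩
          + toℕ i + + s - + q                ≡⟨ regroup (+ toℕ i) (+ s) (+ q) ⟩
          + toℕ i - (+ q + (0ℤ - + s))       ≡⟨ cong (λ x → + toℕ i - (+ q + x)) D≡ ⟨
          + toℕ i - (+ q + D (punchIn P i))  ∎
          where
          open ≡-Reasoning
          regroup : ∀ t s q → t + s - q ≡ t - (q + (0ℤ - s))
          regroup = solve-∀

      bound : + n * + q ≤ D P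
      bound = linSys-K-bound D (rank E (staircase-effective q j)
                (trans (deg-staircase j q≤n) (cong +_ staircase≡))) (+ q) small

      qn+j≤m : q ℕ.* n ℕ.+ j ℕ.≤ m
      qn+j≤m = subst (ℕ._≤ m) (ℕ.+-comm j _) (pos-n≤o-m⇒m+n≤o (subst₂ _≤_ nq≡ D-at-P bound))
        where
        nq≡ : + n * + q ≡ + (q ℕ.* n)
        nq≡ = trans (sym (pos-* n q)) (cong +_ (ℕ.*-comm n q))
        D-at-P : D P ≡ + m - + j
        D-at-P = cong₂ _-_ (·-at Kₙ₊₁ (+ m) P) (insertAt-lookup _ P (+ j))

    rank-mP : ∀ m → HasRank Kₙ₊₁ ((+ m) ·P) (+ σ m)
    rank-mP m = inj₂ (σ m , refl , nonempty , rankCond-σ m , maximal)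
      where
      nonempty = effective⇒linSys Kₙ₊₁ ((+ m) ·P) (·-effective Kₙ₊₁ (+≤+ ℕ.z≤n) P)
      maximal : ∀ k′ → σ m ℕ.< k′ → ¬ RankCond Kₙ₊₁ ((+ m) ·P) k′
      maximal k′ σm<k′ = ¬rankCond-suc-σ m ∘ RankCond-antitone Kₙ₊₁ P ((+ m) ·P) σm<k′

    rank-−P : HasRank Kₙ₊₁ (-1ℤ ·P) -1ℤ
    rank-−P = inj₁ (refl , λ nonempty → bad (subst (_≤ -1ℤ) (*-zeroʳ (+ n))
      (subst (+ n * 0ℤ ≤_) (·-at Kₙ₊₁ -1ℤ P) (linSys-K-bound (-1ℤ ·P) nonempty 0ℤ small))))
      where
      bad : ¬ 0ℤ ≤ -1ℤ
      bad ()
      small : ∀ i → 0ℤ + (-1ℤ ·P) (punchIn P i) ≤ + toℕ i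
      small i = subst (_≤ + toℕ i) (cong (_+_ 0ℤ) (sym (·-away Kₙ₊₁ -1ℤ (punchInᵢ≢i P i ∘ sym))))
                      (+≤+ ℕ.z≤n)

open import Data.Nat using (zero)
open import Data.Integer using (+_; -1ℤ; _<_; +<+; -<+)
open import Data.Integer.Properties using (drop‿+<+)
open import Data.Product using (_,_)
open import Relation.Binary.PropositionalEquality using (refl; subst₂)

corollary3p8 : ∀ (n : ℕ) → n ≥ 1 → (P : Fin (suc n)) → (m : ℕ) →
    (InHr (K (suc n)) P m → InMonoid₂ n (suc n) m) × (InMonoid₂ n (suc n) m → InHr (K (suc n)) P m)
corollary3p8 zero () P m
corollary3p8 (suc n0) _ P m = jump⇒∈ m , ∈⇒jump m
  where
  open NumericalSemigroup n0 using (n; σ; σ-increase⇒∈; ∈⇒σ-increase)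
  open Divisors using (hasRank-functional)
  open Divisors.CompleteGraph n P using (Kₙ₊₁)
  open Divisors.RankOnK n0 P using (rank-mP; rank-−P)

  jump⇒∈ : ∀ m → InHr Kₙ₊₁ P m → InMonoid₂ n (suc n) m
  jump⇒∈ zero    _ = 0 , 0 , refl
  jump⇒∈ (suc m) (_ , _ , rank₁ , rank₀ , r₀<r₁) = σ-increase⇒∈ m (drop‿+<+ (subst₂ _<_
    (hasRank-functional Kₙ₊₁ _ rank₀ (rank-mP m))
    (hasRank-functional Kₙ₊₁ _ rank₁ (rank-mP (suc m))) r₀<r₁))

  ∈⇒jump : ∀ m → InMonoid₂ n (suc n) m → InHr Kₙ₊₁ P m
  ∈⇒jump zero    _   = + 0 , -1ℤ , rank-mP 0 , rank-−P , -<+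
  ∈⇒jump (suc m) mem = + σ (suc m) , + σ m , rank-mP (suc m) , rank-mP m , +<+ (∈⇒σ-increase m mem)
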